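{- Let $X$ be a finite asymmetric graph, let $S$ be a unique-neighbourhood clique in $X$, and suppose that for some $v\in S$ the set $S\cap[v]$ has odd cardinality. If $\langle N(v,X)\rangle$ or $\langle\bigcap_{w\in S}N(w,X)\rangle$ does not have an automorphism that is a product of transpositions, then $X$ is not the induced neighbourhood of a finite vertex-transitive graph (i.e. there is no finite vertex-transitive graph $Y$ with $\langle N(y,Y)\rangle\cong X$ for its vertices $y$).
   Context: All graphs are simple. $N(v,X)$ is the set of neighbours of $v$ in $X$, and $\langle A\rangle$ is the subgraph induced on $A$. A graph is asymmetric if its only automorphism is the identity. $[v]=\{w\in V(X):\langle N(w,X)\rangle\cong\langle N(v,X)\rangle\}$. A clique $S$ of $X$ is a unique-neighbourhood clique if for every clique $S'\neq S$ of $X$ with $|S'|=|S|$, $\langle\bigcap_{w\in S'}N(w,X)\rangle\not\cong\langle\bigcap_{w\in S}N(w,X)\rangle$. An automorphism of a graph is called a product of transpositions if, as a permutation of the vertex set, it is a product of disjoint transpositions moving every vertex (a fixed-point-free involution; for the graph with no vertices, the identity). -}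

module Defs where

open import Data.Nat using (ℕ; _%_)
open import Data.Bool using (Bool; true; false; _∨_; not)
open import Data.Fin using (Fin)
open import Data.Fin.Subset using (Subset; _∈_; ∣_∣; ⊤)
open import Data.Fin.Properties using (all?)
open import Data.Vec using (tabulate; lookup)
open import Data.Product using (Σ; Σ-syntax; ∃; ∃-syntax; _×_; _,_; proj₁)
open import Data.Sum using (_⊎_)
open import Relation.Nullary using (¬_)
open import Relation.Nullary.Decidable using (⌊_⌋)
open import Relation.Binary.PropositionalEquality using (_≡_; _≢_)
open import Data.Bool.Properties using (_≟_)
open import Function.Bundles using (_⇔_)

record Graph : Set where
  field
    n      : ℕ
    adj    : Fin n → Fin n → Bool
    sym    : ∀ u v → adj u v ≡ adj v u
    irrefl : ∀ v → adj v v ≡ false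
open Graph public

V : Graph → Set
V X = Fin (n X)

VSet : Graph → Set
VSet X = Subset (n X)

El : (X : Graph) → VSet X → Set
El X A = Σ[ v ∈ V X ] (v ∈ A)

record IndIso (X : Graph) (A : VSet X) (Y : Graph) (B : VSet Y) : Set where
  field
    to      : El X A → El Y B
    from    : El Y B → El X A
    from∘to : ∀ x → proj₁ (from (to x)) ≡ proj₁ x
    to∘from : ∀ y → proj₁ (to (from y)) ≡ proj₁ y
    pres    : ∀ x y → adj X (proj₁ x) (proj₁ y) ≡ adj Y (proj₁ (to x)) (proj₁ (to y))

record Aut (X : Graph) : Set where
  field
    fun     : V X → V X
    inv     : V X → V X
    inv∘fun : ∀ v → inv (fun v) ≡ v
    fun∘inv : ∀ v → fun (inv v) ≡ v
    pres    : ∀ u v → adj X u v ≡ adj X (fun u) (fun v)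
open Aut public

Asymmetric : Graph → Set
Asymmetric X = (σ : Aut X) → ∀ v → fun σ v ≡ v

VertexTransitive : Graph → Set
VertexTransitive Y = ∀ (y y′ : V Y) → Σ[ σ ∈ Aut Y ] fun σ y ≡ y′

N : (X : Graph) → V X → VSet X
N X v = tabulate (adj X v)

CommonN : (X : Graph) → VSet X → VSet X
CommonN X S = tabulate λ u → ⌊ all? (λ w → (not (lookup S w) ∨ adj X w u) ≟ true) ⌋

_≅⟨_⟩_ : {X : Graph} → VSet X → (Y : Graph) → VSet Y → Set
_≅⟨_⟩_ {X} A Y B = IndIso X A Y B

IsClique : (X : Graph) → VSet X → Set
IsClique X S = ∀ u w → u ∈ S → w ∈ S → u ≢ w → adj X u w ≡ true

UniqueNbhdClique : (X : Graph) → VSet X → Set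
UniqueNbhdClique X S =
  IsClique X S ×
  (∀ (S′ : VSet X) → IsClique X S′ → S′ ≢ S → ∣ S′ ∣ ≡ ∣ S ∣ →
     ¬ IndIso X (CommonN X S′) X (CommonN X S))

-- an automorphism of ⟨A⟩ that is a product of (disjoint) transpositions
-- moving every vertex: a fixed-point-free involution
record FPFInvolution (X : Graph) (A : VSet X) : Set where
  field
    σ      : El X A → El X A
    invol  : ∀ x → proj₁ (σ (σ x)) ≡ proj₁ x
    moves  : ∀ x → proj₁ (σ x) ≢ proj₁ x
    pres   : ∀ x y → adj X (proj₁ x) (proj₁ y) ≡ adj X (proj₁ (σ x)) (proj₁ (σ y))

-- [v] as a predicate: w ∈ [v] iff ⟨N(w)⟩ ≅ ⟨N(v)⟩
InClass : (X : Graph) → V X → V X → Set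
InClass X v w = IndIso X (N X w) X (N X v)

-- |S ∩ [v]| is odd: witnessed by the subset T = S ∩ [v]
OddClassMeet : (X : Graph) → VSet X → V X → Set
OddClassMeet X S v =
  Σ[ T ∈ VSet X ] ((∀ w → (w ∈ T) ⇔ (w ∈ S × InClass X v w)) × (∣ T ∣ % 2 ≡ 1))

-- X is the induced neighbourhood of a finite (nonempty) vertex-transitive graph
IsVTNeighbourhood : Graph → Set
IsVTNeighbourhood X =
  Σ[ Y ∈ Graph ] (VertexTransitive Y × V Y × (∀ (y : V Y) → IndIso Y (N Y y) X ⊤))

{-# OPTIONS --safe #-}
module Submission where

-- Let Y be vertex-transitive with ⟨N(c, Y)⟩ ≅ X for every vertex c, and fix isomorphisms
-- ψ_c from X onto ⟨N(c)⟩. Since X is asymmetric, σ ∘ ψ_c = ψ_{σ c} for every automorphism σ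
-- of Y; in particular an automorphism fixing a vertex fixes its neighbourhood.
--
-- Fix y and let ι w be the label of y in the chart at ψ_y w. Vertex-transitivity makes ι an
-- involution of X. Both ⟨N(w)⟩ and ⟨N(ι w)⟩ are isomorphic to the common neighbourhood of
-- the edge {y, ψ_y w}, so ι preserves [v]. For w ∈ S, the clique K = {y} ∪ ψ_y(S) read in the chart at
-- ψ_y w is a clique of size |S| whose common neighbourhood is isomorphic to that of S, so it is
-- S by uniqueness; hence ι preserves S. An involution of the odd set S ∩ [v] has a fixed point w.
--
-- An automorphism h with h y = ψ_y w then swaps y and ψ_y w, and x ↦ ψ_y⁻¹ (h (ψ_y x)) is an
-- involution of both ⟨N(w)⟩ ≅ ⟨N(v)⟩ and ⟨⋂_{s ∈ S} N(s)⟩; it has no fixed point, since h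
-- would otherwise fix a neighbour of y and hence y itself.

open import Defs hiding (n; sym)

open import Algebra.Definitions using (Involutive)
open import Data.Bool using (Bool; true; false; not; _∨_)
open import Data.Bool.Properties using (T-≡) renaming (_≟_ to _≟ᵇ_)
open import Data.Fin using (Fin; zero; suc; _≟_)
open import Data.Fin.Properties using (any?; all?)
open import Data.Fin.Subset using (Subset; inside; outside; _∈_; _∉_; ∣_∣; _-_; ⁅_⁆; _∪_; ⊤; Nonempty)
open import Data.Fin.Subset.Properties
  using (_∈?_; ∈⊤; nonempty?; Empty-unique; ∣⊥∣≡0; p─⊥≡p; p─q⊆p; x∈p∧x≢y⇒x∈p-y; ⊆-antisym;
         x∈⁅x⁆; x∈⁅y⁆⇒x≡y; x∈p∪q⁺; x∈p∪q⁻)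
open import Data.Nat using (ℕ; zero; suc; _≤_; z≤n; s≤s; _%_)
open import Data.Nat.Properties using (suc-injective; ≤-antisym)
open import Data.Sum as Sum using (_⊎_; inj₁; inj₂; [_,_]′)
open import Data.Empty using (⊥; ⊥-elim)
open import Data.Product using (Σ-syntax; ∃; _×_; _,_; proj₁; proj₂)
open import Data.Vec using (_∷_; here; there; tabulate; lookup)
open import Data.Vec.Properties using (≡-dec; lookup∘tabulate; []=⇒lookup; lookup⇒[]=)
open import Data.Vec.Properties.WithK using ([]=-irrelevant)
open import Function using (_∘_; id)
open import Function.Bundles using (_↣_; mk↣; Injection; _⇔_; mk⇔; Equivalence)
open import Relation.Nullary using (¬_; yes; no)
open import Relation.Nullary.Decidable using (Dec; ⌊_⌋; _×-dec_; toWitness; dec-true; isYes≗does)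
open import Relation.Binary.PropositionalEquality

private variable
  m n : ℕ

Elem : Subset n → Set
Elem {n} p = Σ[ x ∈ Fin n ] x ∈ p

Elem-≡ : {p : Subset n} {a b : Elem p} → proj₁ a ≡ proj₁ b → a ≡ b
Elem-≡ {a = x , x∈p} {.x , x∈p′} refl = cong (x ,_) ([]=-irrelevant x∈p x∈p′)

x∉p-x : ∀ {p : Subset n} x → x ∉ p - x
x∉p-x {p = _ ∷ _} zero    ()
x∉p-x {p = _ ∷ _} (suc x) (there x∈p-x) = x∉p-x x x∈p-x

x∈p-y⇒x≢y : ∀ {p : Subset n} {x y} → x ∈ p - y → x ≢ y
x∈p-y⇒x≢y {x = x} x∈p-x refl = x∉p-x x x∈p-x

x∈p-y⇒x∈p : ∀ {p : Subset n} {x y} → x ∈ p - y → x ∈ p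
x∈p-y⇒x∈p {p = p} {y = y} = p─q⊆p p ⁅ y ⁆

x∈p⇒∣p∣≡1+∣p-x∣ : ∀ {p : Subset n} {x} → x ∈ p → ∣ p ∣ ≡ suc ∣ p - x ∣
x∈p⇒∣p∣≡1+∣p-x∣ {p = inside  ∷ p} here          = cong (suc ∘ ∣_∣) (sym (p─⊥≡p p))
x∈p⇒∣p∣≡1+∣p-x∣ {p = inside  ∷ p} (there x∈p) = cong suc (x∈p⇒∣p∣≡1+∣p-x∣ x∈p)
x∈p⇒∣p∣≡1+∣p-x∣ {p = outside ∷ p} (there x∈p) = x∈p⇒∣p∣≡1+∣p-x∣ x∈p

∣p∣≡1+k⇒Nonempty : ∀ {p : Subset n} {k} → ∣ p ∣ ≡ suc k → Nonempty p
∣p∣≡1+k⇒Nonempty {n} {p} ∣p∣≡1+k with nonempty? p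
... | yes nonempty = nonempty
... | no  empty    with () ← trans (sym ∣p∣≡1+k) (trans (cong ∣_∣ (Empty-unique empty)) (∣⊥∣≡0 n))

↣-remove : ∀ {p : Subset m} {q : Subset n} (f : Elem p ↣ Elem q) (a : Elem p) →
           Elem (p - proj₁ a) ↣ Elem (q - proj₁ (Injection.to f a))
↣-remove {p = p} f (x , x∈p) = mk↣ {to = to′} injective′
  where
  open Injection f using (to; injective)
  lift : Elem (p - x) → Elem p
  lift (x′ , x′∈p-x) = x′ , x∈p-y⇒x∈p x′∈p-x
  to′ : Elem (p - x) → Elem (_ - proj₁ (to (x , x∈p)))
  to′ a@(x′ , x′∈p-x) = proj₁ (to (lift a)) , x∈p∧x≢y⇒x∈p-y (proj₂ (to (lift a)))
    (λ eq → x∈p-y⇒x≢y x′∈p-x (cong proj₁ (injective (Elem-≡ eq))))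
  injective′ : ∀ {a b} → to′ a ≡ to′ b → a ≡ b
  injective′ eq = Elem-≡ (cong proj₁ (injective (Elem-≡ (cong proj₁ eq))))

↣⇒∣p∣≤∣q∣ : {p : Subset m} {q : Subset n} → Elem p ↣ Elem q → ∣ p ∣ ≤ ∣ q ∣
↣⇒∣p∣≤∣q∣ f = go _ refl f
  where
  go : ∀ k {p : Subset m} {q : Subset n} → ∣ p ∣ ≡ k → Elem p ↣ Elem q → k ≤ ∣ q ∣
  go zero    _        _ = z≤n
  go (suc k) ∣p∣≡1+k f =
    let a@(x , x∈p) = ∣p∣≡1+k⇒Nonempty ∣p∣≡1+k
        y∈q = proj₂ (Injection.to f a)
    in subst (suc k ≤_) (sym (x∈p⇒∣p∣≡1+∣p-x∣ y∈q))
         (s≤s (go k (suc-injective (trans (sym (x∈p⇒∣p∣≡1+∣p-x∣ x∈p)) ∣p∣≡1+k)) (↣-remove f a)))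

↣-↢⇒∣p∣≡∣q∣ : {p : Subset m} {q : Subset n} → Elem p ↣ Elem q → Elem q ↣ Elem p → ∣ p ∣ ≡ ∣ q ∣
↣-↢⇒∣p∣≡∣q∣ f g = ≤-antisym (↣⇒∣p∣≤∣q∣ f) (↣⇒∣p∣≤∣q∣ g)

module _ (ι : Fin n → Fin n) (ι-involutive : Involutive _≡_ ι) where

  private
    Closed FixedPointFree : Subset n → Set
    Closed p = ∀ {x} → x ∈ p → ι x ∈ p
    FixedPointFree p = ∀ {x} → x ∈ p → ι x ≢ x

  module _ {p : Subset n} (closed : Closed p) (fpf : FixedPointFree p) {x : Fin n} (x∈p : x ∈ p) where

    ∣p∣≡2+∣p-x-ιx∣ : ∣ p ∣ ≡ suc (suc ∣ p - x - ι x ∣)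
    ∣p∣≡2+∣p-x-ιx∣ = trans (x∈p⇒∣p∣≡1+∣p-x∣ x∈p)
      (cong suc (x∈p⇒∣p∣≡1+∣p-x∣ (x∈p∧x≢y⇒x∈p-y (closed x∈p) (fpf x∈p))))

    p-x-ιx-closed : Closed (p - x - ι x)
    p-x-ιx-closed {t} t∈p″ = x∈p∧x≢y⇒x∈p-y (x∈p∧x≢y⇒x∈p-y (closed (x∈p-y⇒x∈p t∈p-x))
        (λ ιt≡x → x∈p-y⇒x≢y t∈p″ (trans (sym (ι-involutive t)) (cong ι ιt≡x))))
        (λ ιt≡ιx → x∈p-y⇒x≢y t∈p-x
           (trans (sym (ι-involutive t)) (trans (cong ι ιt≡ιx) (ι-involutive x))))
      where t∈p-x = x∈p-y⇒x∈p t∈p″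

  fixedPointFree⇒∣p∣%2≡0 : ∀ {p : Subset n} → Closed p → FixedPointFree p → ∣ p ∣ % 2 ≡ 0
  fixedPointFree⇒∣p∣%2≡0 = go _ refl
    where
    go : ∀ k {p : Subset n} → ∣ p ∣ ≡ k → Closed p → FixedPointFree p → k % 2 ≡ 0
    go zero _ _ _ = refl
    go (suc zero) ∣p∣≡1 closed fpf
      with () ← trans (sym ∣p∣≡1) (∣p∣≡2+∣p-x-ιx∣ closed fpf (proj₂ (∣p∣≡1+k⇒Nonempty ∣p∣≡1)))
    go (suc (suc k)) ∣p∣≡2+k closed fpf =
      go k (suc-injective (suc-injective (trans (sym (∣p∣≡2+∣p-x-ιx∣ closed fpf x∈p)) ∣p∣≡2+k)))
           (p-x-ιx-closed closed fpf x∈p) (fpf ∘ x∈p-y⇒x∈p ∘ x∈p-y⇒x∈p)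
      where x∈p = proj₂ (∣p∣≡1+k⇒Nonempty ∣p∣≡2+k)

  ∣p∣%2≡1⇒fixedPoint : ∀ {p : Subset n} → Closed p → ∣ p ∣ % 2 ≡ 1 → ∃ λ x → x ∈ p × ι x ≡ x
  ∣p∣%2≡1⇒fixedPoint {p} closed odd with any? (λ x → x ∈? p ×-dec ι x ≟ x)
  ... | yes fixed = fixed
  ... | no  none with () ← trans (sym odd)
                            (fixedPointFree⇒∣p∣%2≡0 closed (λ x∈p ιx≡x → none (_ , x∈p , ιx≡x)))

isYes⇒ : ∀ {A : Set} (a? : Dec A) → ⌊ a? ⌋ ≡ true → A
isYes⇒ a? = toWitness ∘ Equivalence.from T-≡

⇒isYes : ∀ {A : Set} (a? : Dec A) → A → ⌊ a? ⌋ ≡ true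
⇒isYes a? a = trans (isYes≗does a?) (dec-true a? a)

module _ {f : Fin n → Bool} {x : Fin n} where

  ∈-tabulate⁺ : f x ≡ true → x ∈ tabulate f
  ∈-tabulate⁺ fx≡true = lookup⇒[]= x (tabulate f) (trans (lookup∘tabulate f x) fx≡true)

  ∈-tabulate⁻ : x ∈ tabulate f → f x ≡ true
  ∈-tabulate⁻ x∈ = trans (sym (lookup∘tabulate f x)) ([]=⇒lookup x∈)

preimage : (Fin m → Fin n) → Subset n → Subset m
preimage f q = tabulate (λ x → lookup q (f x))

module _ {f : Fin m → Fin n} {q : Subset n} {x : Fin m} where

  ∈-preimage⁺ : f x ∈ q → x ∈ preimage f q
  ∈-preimage⁺ = ∈-tabulate⁺ ∘ []=⇒lookup

  ∈-preimage⁻ : x ∈ preimage f q → f x ∈ q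
  ∈-preimage⁻ = lookup⇒[]= (f x) q ∘ ∈-tabulate⁻

image : (Fin m → Fin n) → Subset m → Subset n
image f p = tabulate (λ y → ⌊ any? (λ x → x ∈? p ×-dec f x ≟ y) ⌋)

module _ {f : Fin m → Fin n} {p : Subset m} where

  ∈-image⁺ : ∀ {x} → x ∈ p → f x ∈ image f p
  ∈-image⁺ {x} x∈p = ∈-tabulate⁺ (⇒isYes (any? _) (x , x∈p , refl))

  ∈-image⁻ : ∀ {y} → y ∈ image f p → ∃ λ x → x ∈ p × f x ≡ y
  ∈-image⁻ y∈ = isYes⇒ (any? _) (∈-tabulate⁻ y∈)

module _ (X : Graph) where

  ∈N⁺ : ∀ {v x} → adj X v x ≡ true → x ∈ N X v
  ∈N⁺ = ∈-tabulate⁺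

  ∈N⁻ : ∀ {v x} → x ∈ N X v → adj X v x ≡ true
  ∈N⁻ = ∈-tabulate⁻

  ∈CommonN⁺ : ∀ {S x} → (∀ {w} → w ∈ S → adj X w x ≡ true) → x ∈ CommonN X S
  ∈CommonN⁺ {S} {x} adjS = ∈-tabulate⁺ (⇒isYes (all? _) adjS′)
    where
    adjS′ : ∀ w → (not (lookup S w) ∨ adj X w x) ≡ true
    adjS′ w with lookup S w in w∈S
    ... | true  = adjS (lookup⇒[]= w S w∈S)
    ... | false = refl

  ∈CommonN⁻ : ∀ {S x} → x ∈ CommonN X S → ∀ {w} → w ∈ S → adj X w x ≡ true
  ∈CommonN⁻ {S} {x} x∈ {w} w∈S =
    subst (λ b → (not b ∨ adj X w x) ≡ true) ([]=⇒lookup w∈S) (isYes⇒ (all? _) (∈-tabulate⁻ x∈) w)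

adj-sym : ∀ (Y : Graph) {u u′} → adj Y u u′ ≡ true → adj Y u′ u ≡ true
adj-sym Y {u} {u′} = trans (Graph.sym Y u′ u)

adj⇒≢ : ∀ (Y : Graph) {u u′} → adj Y u u′ ≡ true → u ≢ u′
adj⇒≢ Y {u} uu′ refl with () ← trans (sym uu′) (irrefl Y u)

Aut-injective : ∀ {Y : Graph} (σ : Aut Y) {u u′} → fun σ u ≡ fun σ u′ → u ≡ u′
Aut-injective σ {u} {u′} eq = trans (sym (inv∘fun σ u)) (trans (cong (inv σ) eq) (inv∘fun σ u′))

IndIso-∘ : ∀ {X : Graph} {A B C : VSet X} → IndIso X B X C → IndIso X A X B → IndIso X A X C
IndIso-∘ {X} j i = record
  { to      = J.to ∘ I.to
  ; from    = I.from ∘ J.from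
  ; from∘to = λ a → trans (cong (proj₁ ∘ I.from) (Elem-≡ (J.from∘to (I.to a)))) (I.from∘to a)
  ; to∘from = λ c → trans (cong (proj₁ ∘ J.to) (Elem-≡ (I.to∘from (J.from c)))) (J.to∘from c)
  ; pres    = λ a a′ → trans (I.pres a a′) (J.pres (I.to a) (I.to a′))
  }
  where
  module I = IndIso i
  module J = IndIso j

IndIso⊤⇒Aut : ∀ {X : Graph} → IndIso X ⊤ X ⊤ → Aut X
IndIso⊤⇒Aut {X} i = record
  { fun     = λ x → proj₁ (I.to (x , ∈⊤))
  ; inv     = λ x → proj₁ (I.from (x , ∈⊤))
  ; inv∘fun = λ x → trans (cong (proj₁ ∘ I.from) (Elem-≡ refl)) (I.from∘to (x , ∈⊤))
  ; fun∘inv = λ x → trans (cong (proj₁ ∘ I.to) (Elem-≡ refl)) (I.to∘from (x , ∈⊤))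
  ; pres    = λ x x′ → I.pres (x , ∈⊤) (x′ , ∈⊤)
  }
  where module I = IndIso i

FPFInvolution-transport : ∀ {X : Graph} {A B : VSet X} → IndIso X A X B →
                          FPFInvolution X A → FPFInvolution X B
FPFInvolution-transport {X} {A} {B} i f = record
  { σ     = I.to ∘ F.σ ∘ I.from
  ; invol = λ b → begin
      proj₁ (I.to (F.σ (I.from (I.to (F.σ (I.from b))))))   ≡⟨ to-cong (σ-cong (I.from∘to _)) ⟩
      proj₁ (I.to (F.σ (F.σ (I.from b))))                   ≡⟨ to-cong (F.invol _) ⟩
      proj₁ (I.to (I.from b))                               ≡⟨ I.to∘from b ⟩
      proj₁ b                                               ∎
  ; moves = λ b σb≡b → F.moves (I.from b) (begin
      proj₁ (F.σ (I.from b))                    ≡⟨ sym (I.from∘to _) ⟩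
      proj₁ (I.from (I.to (F.σ (I.from b))))    ≡⟨ from-cong (trans σb≡b (sym (I.to∘from b))) ⟩
      proj₁ (I.from (I.to (I.from b)))          ≡⟨ I.from∘to _ ⟩
      proj₁ (I.from b)                          ∎)
  ; pres  = λ b b′ → begin
      adj X (proj₁ b) (proj₁ b′)
        ≡⟨ cong₂ (adj X) (sym (I.to∘from b)) (sym (I.to∘from b′)) ⟩
      adj X (proj₁ (I.to (I.from b))) (proj₁ (I.to (I.from b′)))
        ≡⟨ sym (I.pres _ _) ⟩
      adj X (proj₁ (I.from b)) (proj₁ (I.from b′))
        ≡⟨ F.pres _ _ ⟩
      adj X (proj₁ (F.σ (I.from b))) (proj₁ (F.σ (I.from b′)))
        ≡⟨ I.pres _ _ ⟩
      adj X (proj₁ (I.to (F.σ (I.from b)))) (proj₁ (I.to (F.σ (I.from b′))))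
        ∎
  }
  where
  open ≡-Reasoning
  module I = IndIso i
  module F = FPFInvolution f
  to-cong : ∀ {a a′ : El X A} → proj₁ a ≡ proj₁ a′ → proj₁ (I.to a) ≡ proj₁ (I.to a′)
  to-cong = cong (proj₁ ∘ I.to) ∘ Elem-≡
  from-cong : ∀ {b b′ : El X B} → proj₁ b ≡ proj₁ b′ → proj₁ (I.from b) ≡ proj₁ (I.from b′)
  from-cong = cong (proj₁ ∘ I.from) ∘ Elem-≡
  σ-cong : ∀ {a a′ : El X A} → proj₁ a ≡ proj₁ a′ → proj₁ (F.σ a) ≡ proj₁ (F.σ a′)
  σ-cong = cong (proj₁ ∘ F.σ) ∘ Elem-≡

record Chart (X Y : Graph) (c : V Y) : Set where
  field
    ψ           : V X → V Y
    ψ-injective : ∀ {x x′} → ψ x ≡ ψ x′ → x ≡ x′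
    ψ-adj       : ∀ x x′ → adj X x x′ ≡ adj Y (ψ x) (ψ x′)
    ψ-centre    : ∀ x → adj Y c (ψ x) ≡ true
    φ           : ∀ u → adj Y c u ≡ true → V X
    ψ∘φ         : ∀ u (cu : adj Y c u ≡ true) → ψ (φ u cu) ≡ u

IndIso⇒Chart : ∀ {X Y : Graph} {c : V Y} → IndIso Y (N Y c) X ⊤ → Chart X Y c
IndIso⇒Chart {X} {Y} i = record
  { ψ           = λ x → proj₁ (I.from (x , ∈⊤))
  ; ψ-injective = λ {x} {x′} eq → trans (sym (I.to∘from (x , ∈⊤)))
                                   (trans (cong (proj₁ ∘ I.to) (Elem-≡ eq)) (I.to∘from (x′ , ∈⊤)))
  ; ψ-adj       = λ x x′ → sym (trans (I.pres (I.from (x , ∈⊤)) (I.from (x′ , ∈⊤)))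
                                     (cong₂ (adj X) (I.to∘from (x , ∈⊤)) (I.to∘from (x′ , ∈⊤))))
  ; ψ-centre    = λ x → ∈N⁻ Y (proj₂ (I.from (x , ∈⊤)))
  ; φ           = λ u cu → proj₁ (I.to (u , ∈N⁺ Y cu))
  ; ψ∘φ         = λ u cu → trans (cong (proj₁ ∘ I.from) (Elem-≡ refl)) (I.from∘to (u , ∈N⁺ Y cu))
  }
  where module I = IndIso i

Aut∘Chart : ∀ {X Y : Graph} {c : V Y} (σ : Aut Y) → Chart X Y c → Chart X Y (fun σ c)
Aut∘Chart {X} {Y} {c} σ α = record
  { ψ           = fun σ ∘ ψ
  ; ψ-injective = ψ-injective ∘ Aut-injective σ
  ; ψ-adj       = λ x x′ → trans (ψ-adj x x′) (pres σ (ψ x) (ψ x′))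
  ; ψ-centre    = λ x → trans (sym (pres σ c (ψ x))) (ψ-centre x)
  ; φ           = λ u σc-u → φ (inv σ u) (c-σ⁻¹u σc-u)
  ; ψ∘φ         = λ u σc-u → trans (cong (fun σ) (ψ∘φ _ (c-σ⁻¹u σc-u))) (fun∘inv σ u)
  }
  where
  open Chart α
  c-σ⁻¹u : ∀ {u} → adj Y (fun σ c) u ≡ true → adj Y c (inv σ u) ≡ true
  c-σ⁻¹u {u} σc-u = trans (pres σ c (inv σ u)) (trans (cong (adj Y (fun σ c)) (fun∘inv σ u)) σc-u)

module _ {X Y : Graph} {a b : V Y} (α : Chart X Y a) (β : Chart X Y b) {P : V Y → Set}
         (P⇒b : ∀ {u} → P u → adj Y b u ≡ true) {A B : VSet X}
         (A⇒ : ∀ {x} → x ∈ A → P (Chart.ψ α x)) (B⇐ : ∀ {x} → P (Chart.ψ β x) → x ∈ B) where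
  private
    module α = Chart α
    module β = Chart β

  transfer : El X A → El X B
  transfer (x , x∈A) = β.φ (α.ψ x) (P⇒b (A⇒ x∈A)) , B⇐ (subst P (sym (β.ψ∘φ _ _)) (A⇒ x∈A))

  ψ-transfer : ∀ x → β.ψ (proj₁ (transfer x)) ≡ α.ψ (proj₁ x)
  ψ-transfer (x , x∈A) = β.ψ∘φ _ _

module _ {X Y : Graph} {a b : V Y} (α : Chart X Y a) (β : Chart X Y b) {P : V Y → Set}
         (P⇒a : ∀ {u} → P u → adj Y a u ≡ true) (P⇒b : ∀ {u} → P u → adj Y b u ≡ true) {A B : VSet X}
         (A⇔ : ∀ x → x ∈ A ⇔ P (Chart.ψ α x)) (B⇔ : ∀ x → x ∈ B ⇔ P (Chart.ψ β x)) where
  private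
    module α = Chart α
    module β = Chart β
    open Equivalence
    to′ = transfer α β P⇒b (to (A⇔ _)) (from (B⇔ _))
    from′ = transfer β α P⇒a (to (B⇔ _)) (from (A⇔ _))
    ψ-to′ = ψ-transfer α β P⇒b (to (A⇔ _)) (from (B⇔ _))
    ψ-from′ = ψ-transfer β α P⇒a (to (B⇔ _)) (from (A⇔ _))

  chart-IndIso : IndIso X A X B
  chart-IndIso = record
    { to      = to′
    ; from    = from′
    ; from∘to = λ x → α.ψ-injective (trans (ψ-from′ (to′ x)) (ψ-to′ x))
    ; to∘from = λ x → β.ψ-injective (trans (ψ-to′ (from′ x)) (ψ-from′ x))
    ; pres    = λ x x′ → trans (α.ψ-adj _ _)
        (trans (cong₂ (adj Y) (sym (ψ-to′ x)) (sym (ψ-to′ x′))) (sym (β.ψ-adj _ _)))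
    }

  ψ-chart-IndIso : ∀ x → β.ψ (proj₁ (IndIso.to chart-IndIso x)) ≡ α.ψ (proj₁ x)
  ψ-chart-IndIso = ψ-to′

asymmetric⇒charts-agree : ∀ {X Y : Graph} {c : V Y} → Asymmetric X →
                          (α β : Chart X Y c) → ∀ x → Chart.ψ β x ≡ Chart.ψ α x
asymmetric⇒charts-agree {X} {Y} {c} asym α β x = begin
  Chart.ψ β x
    ≡⟨ cong (Chart.ψ β) (sym (asym (IndIso⊤⇒Aut iso) x)) ⟩
  Chart.ψ β (proj₁ (IndIso.to iso (x , ∈⊤)))
    ≡⟨ ψ-chart-IndIso α β id id (centred α) (centred β) (x , ∈⊤) ⟩
  Chart.ψ α x
    ∎
  where
  open ≡-Reasoning
  centred : (γ : Chart X Y c) → ∀ x → x ∈ ⊤ ⇔ adj Y c (Chart.ψ γ x) ≡ true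
  centred γ x = mk⇔ (λ _ → Chart.ψ-centre γ x) (λ _ → ∈⊤)
  iso : IndIso X ⊤ X ⊤
  iso = chart-IndIso α β id id (centred α) (centred β)

CommonNbr : (Y : Graph) → VSet Y → V Y → Set
CommonNbr Y q u = ∀ {k} → k ∈ q → adj Y k u ≡ true

module _ {X Y : Graph} {a : V Y} (α : Chart X Y a) {q : VSet Y} where
  open Chart α

  preimage-clique : IsClique Y q → IsClique X (preimage ψ q)
  preimage-clique q-clique x x′ x∈ x′∈ x≢x′ =
    trans (ψ-adj x x′) (q-clique _ _ (∈-preimage⁻ x∈) (∈-preimage⁻ x′∈) (x≢x′ ∘ ψ-injective))

  module _ (a∈q : a ∈ q) (q-clique : IsClique Y q) where
    private
      a-adj : ∀ {u} → u ∈ q → u ≢ a → adj Y a u ≡ true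
      a-adj u∈q u≢a = q-clique _ _ a∈q u∈q (u≢a ∘ sym)

      φ∈preimage : ∀ {u} (u∈q : u ∈ q) (au : adj Y a u ≡ true) → φ u au ∈ preimage ψ q
      φ∈preimage u∈q au = ∈-preimage⁺ (subst (_∈ q) (sym (ψ∘φ _ au)) u∈q)

    ∣q∣≡1+∣preimage∣ : ∣ q ∣ ≡ suc ∣ preimage ψ q ∣
    ∣q∣≡1+∣preimage∣ = trans (x∈p⇒∣p∣≡1+∣p-x∣ a∈q) (cong suc (↣-↢⇒∣p∣≡∣q∣ by-φ by-ψ))
      where
      by-ψ : Elem (preimage ψ q) ↣ Elem (q - a)
      by-ψ = mk↣ {to = λ (x , x∈) → ψ x , x∈p∧x≢y⇒x∈p-y (∈-preimage⁻ x∈) (adj⇒≢ Y (ψ-centre x) ∘ sym)}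
                 (Elem-≡ ∘ ψ-injective ∘ cong proj₁)
      by-φ : Elem (q - a) ↣ Elem (preimage ψ q)
      by-φ = mk↣ {to = λ (u , u∈) → φ u (a-adj (x∈p-y⇒x∈p u∈) (x∈p-y⇒x≢y u∈))
                                    , φ∈preimage (x∈p-y⇒x∈p u∈) _}
                 (λ eq → Elem-≡ (trans (sym (ψ∘φ _ _)) (trans (cong (ψ ∘ proj₁) eq) (ψ∘φ _ _))))

    ∈CommonN-preimage⇔ : ∀ x → x ∈ CommonN X (preimage ψ q) ⇔ CommonNbr Y q (ψ x)
    ∈CommonN-preimage⇔ x =
      mk⇔ common (λ common → ∈CommonN⁺ X (λ s∈ → trans (ψ-adj _ _) (common (∈-preimage⁻ s∈))))
      where
      common : x ∈ CommonN X (preimage ψ q) → CommonNbr Y q (ψ x)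
      common x∈ {k} k∈q with k ≟ a
      ... | yes refl = ψ-centre x
      ... | no  k≢a  = subst (λ k → adj Y k (ψ x) ≡ true) (ψ∘φ k (a-adj k∈q k≢a))
                         (trans (sym (ψ-adj _ _)) (∈CommonN⁻ X x∈ (φ∈preimage k∈q (a-adj k∈q k≢a))))

module AsymmetricLinks {X Y : Graph} (asym : Asymmetric X) (chart : (c : V Y) → Chart X Y c) where
  open ≡-Reasoning
  module _ {c : V Y} where open Chart (chart c) public using (ψ-injective; ψ-adj; ψ-centre; φ; ψ∘φ)

  ψ : V Y → V X → V Y
  ψ c = Chart.ψ (chart c)

  Aut-ψ : (σ : Aut Y) (c : V Y) (x : V X) → fun σ (ψ c x) ≡ ψ (fun σ c) x
  Aut-ψ σ c = asymmetric⇒charts-agree asym (chart (fun σ c)) (Aut∘Chart σ (chart c))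

  fixes-centre⇒fixes-nbhd : (σ : Aut Y) {c u : V Y} → fun σ c ≡ c → adj Y c u ≡ true → fun σ u ≡ u
  fixes-centre⇒fixes-nbhd σ {c} {u} σc≡c cu = begin
    fun σ u            ≡⟨ cong (fun σ) (sym (ψ∘φ u cu)) ⟩
    fun σ (ψ c x)      ≡⟨ Aut-ψ σ c x ⟩
    ψ (fun σ c) x      ≡⟨ cong (λ c′ → ψ c′ x) σc≡c ⟩
    ψ c x              ≡⟨ ψ∘φ u cu ⟩
    u                  ∎
    where x = φ u cu

  ∈N⇔ψ : ∀ {c x₀ x} → x ∈ N X x₀ ⇔ adj Y (ψ c x₀) (ψ c x) ≡ true
  ∈N⇔ψ = mk⇔ (λ x∈N → trans (sym (ψ-adj _ _)) (∈N⁻ X x∈N)) (λ c-adj → ∈N⁺ X (trans (ψ-adj _ _) c-adj))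

  N⇔ψ : ∀ {y w} x → x ∈ N X w ⇔ (adj Y y (ψ y x) ≡ true × adj Y (ψ y w) (ψ y x) ≡ true)
  N⇔ψ x = mk⇔ (λ x∈N → ψ-centre x , Equivalence.to ∈N⇔ψ x∈N) (Equivalence.from ∈N⇔ψ ∘ proj₂)

  module _ (h : Aut Y) {y : V Y} {x₀ : V X} (hy : fun h y ≡ ψ y x₀) (hz : fun h (ψ y x₀) ≡ y) where

    h²-fixes-nbhd : ∀ x → fun h (fun h (ψ y x)) ≡ ψ y x
    h²-fixes-nbhd x = begin
      fun h (fun h (ψ y x))   ≡⟨ cong (fun h) (Aut-ψ h y x) ⟩
      fun h (ψ (fun h y) x)   ≡⟨ Aut-ψ h (fun h y) x ⟩
      ψ (fun h (fun h y)) x   ≡⟨ cong (λ c → ψ c x) (trans (cong (fun h) hy) hz) ⟩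
      ψ y x                   ∎

    swap-FPFInvolution : (P : V Y → Set) → (∀ {u} → P u → adj Y y u ≡ true) →
                         (∀ {u} → P u → P (fun h u)) →
                         {A : VSet X} → (∀ x → x ∈ A ⇔ P (ψ y x)) → FPFInvolution X A
    swap-FPFInvolution P P⇒y P-closed {A} A⇔ = record
      { σ     = σ
      ; invol = λ a → ψ-injective (begin
          ψ y (proj₁ (σ (σ a)))     ≡⟨ ψ-σ (σ a) ⟩
          fun h (ψ y (proj₁ (σ a))) ≡⟨ cong (fun h) (ψ-σ a) ⟩
          fun h (fun h (ψ y _))     ≡⟨ h²-fixes-nbhd _ ⟩
          ψ y (proj₁ a)             ∎)
      ; moves = λ a σa≡a → adj⇒≢ Y (ψ-centre x₀) (begin
          y          ≡⟨ sym (fixes-centre⇒fixes-nbhd h (h-fixes a σa≡a) (adj-sym Y (ψ-centre _))) ⟩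
          fun h y    ≡⟨ hy ⟩
          ψ y x₀     ∎)
      ; pres  = λ a a′ → begin
          adj X (proj₁ a) (proj₁ a′)                               ≡⟨ ψ-adj _ _ ⟩
          adj Y (ψ y (proj₁ a)) (ψ y (proj₁ a′))                   ≡⟨ pres h _ _ ⟩
          adj Y (fun h (ψ y (proj₁ a))) (fun h (ψ y (proj₁ a′)))
            ≡⟨ cong₂ (adj Y) (sym (ψ-σ a)) (sym (ψ-σ a′)) ⟩
          adj Y (ψ y (proj₁ (σ a))) (ψ y (proj₁ (σ a′)))           ≡⟨ sym (ψ-adj _ _) ⟩
          adj X (proj₁ (σ a)) (proj₁ (σ a′))                       ∎
      }
      where
      open Equivalence
      σ : El X A → El X A
      σ = transfer (Aut∘Chart h (chart y)) (chart y) P⇒y (P-closed ∘ to (A⇔ _)) (from (A⇔ _))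
      ψ-σ : ∀ a → ψ y (proj₁ (σ a)) ≡ fun h (ψ y (proj₁ a))
      ψ-σ = ψ-transfer (Aut∘Chart h (chart y)) (chart y) P⇒y (P-closed ∘ to (A⇔ _)) (from (A⇔ _))
      h-fixes : ∀ a → proj₁ (σ a) ≡ proj₁ a → fun h (ψ y (proj₁ a)) ≡ ψ y (proj₁ a)
      h-fixes a σa≡a = trans (sym (ψ-σ a)) (cong (ψ y) σa≡a)

  module _ (y : V Y) where

    ι : V X → V X
    ι w = φ y (adj-sym Y (ψ-centre w))

    ψ-ι : ∀ w → ψ (ψ y w) (ι w) ≡ y
    ψ-ι w = ψ∘φ y _

    ι-involutive : VertexTransitive Y → Involutive _≡_ ι
    ι-involutive vt w = ψ-injective (trans (ψ-ι (ι w)) (sym ψz′w≡y))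
      where
      z  = ψ y w
      z′ = ψ y (ι w)
      g  = proj₁ (vt y z)
      gy≡z : fun g y ≡ z
      gy≡z = proj₂ (vt y z)
      gz′≡y : fun g z′ ≡ y
      gz′≡y = trans (Aut-ψ g y (ι w)) (trans (cong (λ c → ψ c (ι w)) gy≡z) (ψ-ι w))
      ψz′w≡y : ψ z′ w ≡ y
      ψz′w≡y = Aut-injective g (begin
        fun g (ψ z′ w)   ≡⟨ Aut-ψ g z′ w ⟩
        ψ (fun g z′) w   ≡⟨ cong (λ c → ψ c w) gz′≡y ⟩
        z                ≡⟨ sym gy≡z ⟩
        fun g y          ∎)

    N-ι≅N : ∀ w → IndIso X (N X (ι w)) X (N X w)
    N-ι≅N w = chart-IndIso (chart z) (chart y)
      {P = λ u → adj Y y u ≡ true × adj Y z u ≡ true} proj₂ proj₁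
      (λ x → mk⇔ (λ x∈N → to (N-ιw x) x∈N , ψ-centre x) (from (N-ιw x) ∘ proj₁))
      N⇔ψ
      where
      open Equivalence
      z = ψ y w
      N-ιw : ∀ x → x ∈ N X (ι w) ⇔ adj Y y (ψ z x) ≡ true
      N-ιw x = subst (λ c → x ∈ N X (ι w) ⇔ adj Y c (ψ z x) ≡ true) (ψ-ι w) ∈N⇔ψ

  self-paired⇒swap : VertexTransitive Y → ∀ {y w} → ι y w ≡ w →
                     Σ[ h ∈ Aut Y ] fun h y ≡ ψ y w × fun h (ψ y w) ≡ y
  self-paired⇒swap vt {y} {w} ιw≡w = h , hy , (begin
    fun h (ψ y w)       ≡⟨ Aut-ψ h y w ⟩
    ψ (fun h y) w       ≡⟨ cong (λ c → ψ c w) hy ⟩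
    ψ (ψ y w) w         ≡⟨ cong (ψ (ψ y w)) (sym ιw≡w) ⟩
    ψ (ψ y w) (ι y w)   ≡⟨ ψ-ι y w ⟩
    y                   ∎)
    where
    h = proj₁ (vt y (ψ y w))
    hy = proj₂ (vt y (ψ y w))

  N-FPFInvolution : (h : Aut Y) {y : V Y} {w : V X} → fun h y ≡ ψ y w → fun h (ψ y w) ≡ y →
                    FPFInvolution X (N X w)
  N-FPFInvolution h {y} {w} hy hz = swap-FPFInvolution h hy hz _ proj₁ swapped N⇔ψ
    where
    swapped : ∀ {u} → adj Y y u ≡ true × adj Y (ψ y w) u ≡ true →
              adj Y y (fun h u) ≡ true × adj Y (ψ y w) (fun h u) ≡ true
    swapped {u} (yu , zu) = subst (λ c → adj Y c (fun h u) ≡ true) hz (trans (sym (pres h _ u)) zu)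
                          , subst (λ c → adj Y c (fun h u) ≡ true) hy (trans (sym (pres h _ u)) yu)

  module CliqueCone {S : VSet X} (ucl : UniqueNbhdClique X S) (y : V Y) where

    K : VSet Y
    K = ⁅ y ⁆ ∪ image (ψ y) S

    y∈K : y ∈ K
    y∈K = x∈p∪q⁺ (inj₁ (x∈⁅x⁆ y))

    ψS⊆K : ∀ {s} → s ∈ S → ψ y s ∈ K
    ψS⊆K = x∈p∪q⁺ ∘ inj₂ ∘ ∈-image⁺

    K-elim : ∀ {k} → k ∈ K → k ≡ y ⊎ ∃ λ s → s ∈ S × ψ y s ≡ k
    K-elim k∈K = Sum.map (x∈⁅y⁆⇒x≡y y) ∈-image⁻ (x∈p∪q⁻ _ _ k∈K)

    K-clique : IsClique Y K
    K-clique k k′ k∈K k′∈K k≢k′ with K-elim k∈K | K-elim k′∈K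
    ... | inj₁ refl             | inj₁ refl               = ⊥-elim (k≢k′ refl)
    ... | inj₁ refl             | inj₂ (s′ , _ , refl)     = ψ-centre s′
    ... | inj₂ (s , _ , refl)   | inj₁ refl               = adj-sym Y (ψ-centre s)
    ... | inj₂ (s , s∈S , refl) | inj₂ (s′ , s′∈S , refl) =
      trans (sym (ψ-adj s s′)) (proj₁ ucl s s′ s∈S s′∈S (k≢k′ ∘ cong (ψ y)))

    S≡preimage : S ≡ preimage (ψ y) K
    S≡preimage = ⊆-antisym (∈-preimage⁺ ∘ ψS⊆K) (λ x∈ → in-S (K-elim (∈-preimage⁻ x∈)))
      where
      in-S : ∀ {x} → ψ y x ≡ y ⊎ ∃ (λ s → s ∈ S × ψ y s ≡ ψ y x) → x ∈ S
      in-S {x} (inj₁ ψx≡y)           = ⊥-elim (adj⇒≢ Y (ψ-centre x) (sym ψx≡y))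
      in-S     (inj₂ (s , s∈S , eq)) = subst (_∈ S) (ψ-injective eq) s∈S

    CommonN⇔ψ : ∀ x → x ∈ CommonN X S ⇔ CommonNbr Y K (ψ y x)
    CommonN⇔ψ = subst (λ S′ → ∀ x → x ∈ CommonN X S′ ⇔ CommonNbr Y K (ψ y x)) (sym S≡preimage)
                  (∈CommonN-preimage⇔ (chart y) y∈K K-clique)

    module _ {w : V X} (w∈S : w ∈ S) where
      private
        z = ψ y w
        z∈K = ψS⊆K w∈S

      preimage-K≡S : preimage (ψ z) K ≡ S
      preimage-K≡S with ≡-dec _≟ᵇ_ (preimage (ψ z) K) S
      ... | yes eq  = eq
      ... | no  neq = ⊥-elim (proj₂ ucl _ (preimage-clique (chart z) K-clique) neq same-size CommonN-iso)
        where
        same-size : ∣ preimage (ψ z) K ∣ ≡ ∣ S ∣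
        same-size = suc-injective (begin
          suc ∣ preimage (ψ z) K ∣   ≡⟨ sym (∣q∣≡1+∣preimage∣ (chart z) z∈K K-clique) ⟩
          ∣ K ∣                      ≡⟨ ∣q∣≡1+∣preimage∣ (chart y) y∈K K-clique ⟩
          suc ∣ preimage (ψ y) K ∣   ≡⟨ cong (suc ∘ ∣_∣) (sym S≡preimage) ⟩
          suc ∣ S ∣                  ∎)
        CommonN-iso : IndIso X (CommonN X (preimage (ψ z) K)) X (CommonN X S)
        CommonN-iso = chart-IndIso (chart z) (chart y) {P = CommonNbr Y K}
                        (λ common → common z∈K) (λ common → common y∈K)
                        (∈CommonN-preimage⇔ (chart z) z∈K K-clique) CommonN⇔ψ

      ι-preserves-S : ι y w ∈ S
      ι-preserves-S = subst (ι y w ∈_) preimage-K≡S (∈-preimage⁺ (subst (_∈ K) (sym (ψ-ι y w)) y∈K))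

      CommonN-FPFInvolution : (h : Aut Y) → fun h y ≡ z → fun h z ≡ y → FPFInvolution X (CommonN X S)
      CommonN-FPFInvolution h hy hz = swap-FPFInvolution h hy hz (CommonNbr Y K) (λ common → common y∈K)
                                        h-preserves-common CommonN⇔ψ
        where
        h-K : ∀ {k} → k ∈ K → fun h k ∈ K
        h-K k∈K with K-elim k∈K
        ... | inj₁ refl             = subst (_∈ K) (sym hy) z∈K
        ... | inj₂ (s , s∈S , refl) = subst (_∈ K) (sym (trans (Aut-ψ h y s) (cong (λ c → ψ c s) hy)))
                                        (∈-preimage⁻ (subst (s ∈_) (sym preimage-K≡S) s∈S))
        h²-K : ∀ {k} → k ∈ K → fun h (fun h k) ≡ k
        h²-K k∈K with K-elim k∈K
        ... | inj₁ refl           = trans (cong (fun h) hy) hz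
        ... | inj₂ (s , _ , refl) = h²-fixes-nbhd h hy hz s
        h-preserves-common : ∀ {u} → CommonNbr Y K u → CommonNbr Y K (fun h u)
        h-preserves-common {u} common {k} k∈K = begin
          adj Y k (fun h u)                 ≡⟨ cong (λ k′ → adj Y k′ (fun h u)) (sym (h²-K k∈K)) ⟩
          adj Y (fun h (fun h k)) (fun h u) ≡⟨ sym (pres h _ u) ⟩
          adj Y (fun h k) u                 ≡⟨ common (h-K k∈K) ⟩
          true                              ∎

theorem2p7 : (X : Graph) → Asymmetric X → (S : VSet X) → UniqueNbhdClique X S →
    (v : V X) → v ∈ S → OddClassMeet X S v →
    (¬ FPFInvolution X (N X v) ⊎ ¬ FPFInvolution X (CommonN X S)) →
    ¬ IsVTNeighbourhood X
theorem2p7 X asym S ucl v _ (T , T⇔ , ∣T∣-odd) no-FPF (Y , vt , y , nbhd) = absurd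
  where
  open AsymmetricLinks asym (IndIso⇒Chart ∘ nbhd)
  open CliqueCone ucl y
  open Equivalence

  T-closed : ∀ {w} → w ∈ T → ι y w ∈ T
  T-closed {w} w∈T with w∈S , w∼v ← to (T⇔ w) w∈T =
    from (T⇔ (ι y w)) (ι-preserves-S w∈S , IndIso-∘ w∼v (N-ι≅N y w))

  absurd : ⊥
  absurd
    with w , w∈T , ιw≡w ← ∣p∣%2≡1⇒fixedPoint (ι y) (ι-involutive y vt) T-closed ∣T∣-odd
    with w∈S , w∼v      ← to (T⇔ w) w∈T
    with h , hy , hz    ← self-paired⇒swap vt ιw≡w
    = [ (λ ¬FPF-N → ¬FPF-N (FPFInvolution-transport w∼v (N-FPFInvolution h hy hz)))
      , (λ ¬FPF-C → ¬FPF-C (CommonN-FPFInvolution w∈S h hy hz))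
      ]′ no-FPF
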